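{- Let $G$ be a finite simple graph with $\dim_{\mathrm{poc}}(G)\ge 2$, and let $G'$ be a graph obtained from $G$ by adding isolated vertices. Then $\dim_{\mathrm{poc}}(G)=\dim_{\mathrm{poc}}(G')$.
   Context: For $\mathbf{x},\mathbf{y}\in\mathbb{R}^d$, $\mathbf{x}\prec\mathbf{y}$ means $x_i<y_i$ for all $i$. For finite $S\subseteq\mathbb{R}^d$, $D_S$ is the digraph on $S$ with an arc $(\mathbf{x},\mathbf{v})$ whenever $\mathbf{v}\prec\mathbf{x}$; by convention $\mathbb{R}^0$ is a single point. The competition graph $C(D)$ of a digraph $D$ has vertex set $V(D)$ and an edge between distinct $x,y$ iff some $z$ has arcs $(x,z),(y,z)$. The partial order competition dimension $\dim_{\mathrm{poc}}(G)$ is the smallest nonnegative integer $d$ such that for some nonnegative integer $k$ and some finite $S\subseteq\mathbb{R}^d$, the disjoint union of $G$ and $k$ isolated vertices is isomorphic to $C(D_S)$.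
   Formalization: The finite sets S in the definition of $\dim_{\mathrm{poc}}$ lie in ℚ^d rather than ℝ^d. -}

module Defs where

open import Data.Nat using (ℕ; _+_; _≤_)
open import Data.Fin using (Fin; _↑ˡ_; _↑ʳ_)
open import Data.Rational using (ℚ; _<_)
open import Data.Product using (Σ; ∃; ∃-syntax; _×_; _,_)
open import Data.Empty using (⊥)
open import Relation.Nullary using (¬_)
open import Relation.Binary.PropositionalEquality using (_≡_; refl; subst; trans) renaming (sym to sym≡)
open import Data.Fin.Properties using (↑ˡ-injective)
open import Function.Bundles using (_⤖_; Bijection; _⇔_)

record Graph : Set₁ where
  field
    n      : ℕ
    Adj    : Fin n → Fin n → Set
    sym    : ∀ {u v} → Adj u v → Adj v u
    irrefl : ∀ {u} → ¬ Adj u u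
open Graph public

Iso : Graph → Graph → Set
Iso G H = Σ (Fin (n G) ⤖ Fin (n H)) λ f →
  ∀ u v → Adj G u v ⇔ Adj H (Bijection.to f u) (Bijection.to f v)

-- Disjoint union of G with k isolated vertices (new vertices are n G ↑ʳ i).
AddAdj : (G : Graph) (k : ℕ) → Fin (n G + k) → Fin (n G + k) → Set
AddAdj G k u v = ∃[ i ] ∃[ j ] (u ≡ i ↑ˡ k × v ≡ j ↑ˡ k × Adj G i j)

addIsolated : Graph → ℕ → Graph
addIsolated G k = record
  { n = n G + k ; Adj = AddAdj G k
  ; sym = λ { (i , j , p , q , a) → j , i , q , p , sym G a }
  ; irrefl = λ { (i , j , p , q , a) →
      irrefl G (subst (Adj G i) (sym≡ (↑ˡ-injective k i j (trans (sym≡ p) q))) a) } }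

-- Points of ℝ^d (with ℚ in place of ℝ) and the strict product order.
Point : ℕ → Set
Point d = Fin d → ℚ

_≺_ : ∀ {d} → Point d → Point d → Set
x ≺ y = ∀ i → x i < y i

record PointSet (d : ℕ) : Set where
  field
    m     : ℕ
    pt    : Fin m → Point d
    inj   : ∀ a b → (∀ i → pt a i ≡ pt b i) → a ≡ b
open PointSet public

-- The competition graph C(D_S): distinct a, b adjacent iff some c has
-- arcs (a,c),(b,c) in D_S, i.e. pt c ≺ pt a and pt c ≺ pt b.
compGraph : ∀ {d} → PointSet d → Graph
compGraph S = record
  { n = m S
  ; Adj = λ a b → ¬ (a ≡ b) × ∃[ c ] (pt S c ≺ pt S a × pt S c ≺ pt S b)
  ; sym = λ { (ne , c , p , q) → (λ e → ne (sym≡ e)) , c , q , p }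
  ; irrefl = λ { (ne , _) → ne refl } }

PocRep : Graph → ℕ → Set
PocRep G d = ∃[ k ] Σ (PointSet d) λ S → Iso (addIsolated G k) (compGraph S)

IsPocDim : Graph → ℕ → Set
IsPocDim G d = PocRep G d × (∀ d′ → PocRep G d′ → d ≤ d′)

module Submission where

-- A representation of G′ ≅ G ∪ jK₁ together with k isolated vertices is a representation of G with
-- j + k isolated vertices, so dim_poc(G) ≤ dim_poc(G′). Conversely, when d ≥ 2 any S ⊆ ℚ^d can be
-- enlarged by j points (t, −t, 0, …, 0) with t beyond every point of S: they are incomparable with
-- each other and with S, so they only add j isolated vertices to C(D_S). Hence a d-dimensional
-- representation of G gives one of G′.

open import Defs hiding (sym)
import Algebra.Properties.Group
open import Data.Empty using (⊥-elim)
open import Data.Fin using (Fin; zero; suc; _↑ˡ_; splitAt; cast; toℕ)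
open import Data.Fin.Properties
  using (+↔⊎; splitAt-↑ˡ; splitAt⁻¹-↑ˡ; ↑ˡ-injective; toℕ-cast; toℕ-↑ˡ; toℕ-injective; cast-involutive)
import Data.Integer as ℤ
open import Data.List using (tabulate)
import Data.List.Extrema
open import Data.List.Relation.Unary.All.Properties using (tabulate⁻)
open import Data.Nat using (ℕ; _+_; _≤_; s≤s; z≤n)
open import Data.Nat.Properties using (+-assoc; +-comm; suc-injective)
open import Data.Product using (Σ-syntax; ∃-syntax; ∃₂; _×_; _,_)
open import Data.Rational using (ℚ; 0ℚ; -_; _⊔_; _<_) renaming (_+_ to _+ℚ_; _≤_ to _≤ℚ_)
open import Data.Rational.Literals using (fromℤ)
open import Data.Rational.Properties
  using (≤-decTotalOrder; +-0-group; ≤-<-trans; <-asym; <-irrefl; neg-antimono-<; +-monoʳ-<; +-identityʳ;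
         positive⁻¹; p≤p⊔q; p≤q⊔p)
open import Data.Sum using (inj₁; inj₂; [_,_]′)
open import Data.Sum.Function.Propositional using (_⊎-↔_)
open import Function.Base using (_∘_)
open import Function.Bundles using (_↔_; Inverse; Injection; Equivalence; mk⇔; mk↔ₛ′)
open import Function.Properties.Bijection using (⤖⇒↔)
open import Function.Properties.Inverse using (↔-refl; ↔-sym; ↔-trans; ↔⇒⤖; ↔⇒↣)
open import Relation.Binary.Bundles using (DecTotalOrder)
open import Relation.Binary.PropositionalEquality using (_≡_; refl; sym; trans; cong; subst; subst₂)
open import Relation.Nullary using (¬_)

open Algebra.Properties.Group +-0-group using (∙-cancelˡ; ⁻¹-involutive)
open Data.List.Extrema (DecTotalOrder.totalOrder ≤-decTotalOrder) using (max; xs≤max)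

open Inverse using (to; from; strictlyInverseˡ; strictlyInverseʳ)

-- Iso with the inverse made explicit; being a record, its graphs are inferable from its proofs.
record _≅_ (G H : Graph) : Set where
  field
    vertices : Fin (n G) ↔ Fin (n H)
    to-adj   : ∀ {u v} → Adj G u v → Adj H (to vertices u) (to vertices v)
    from-adj : ∀ {u v} → Adj H u v → Adj G (from vertices u) (from vertices v)
open _≅_

≅-sym : ∀ {G H} → G ≅ H → H ≅ G
≅-sym φ = record { vertices = ↔-sym (vertices φ) ; to-adj = from-adj φ ; from-adj = to-adj φ }

≅-trans : ∀ {G H K} → G ≅ H → H ≅ K → G ≅ K
≅-trans φ ψ = record
  { vertices = ↔-trans (vertices φ) (vertices ψ)
  ; to-adj   = to-adj ψ ∘ to-adj φ
  ; from-adj = from-adj φ ∘ from-adj ψ }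

≅⇒Iso : ∀ {G H} → G ≅ H → Iso G H
≅⇒Iso {G} φ = ↔⇒⤖ f , λ u v →
  mk⇔ (to-adj φ) (subst₂ (Adj G) (strictlyInverseʳ f u) (strictlyInverseʳ f v) ∘ from-adj φ)
  where f = vertices φ

Iso⇒≅ : ∀ {G H} → Iso G H → G ≅ H
Iso⇒≅ {G} {H} (f , adj) = record
  { vertices = f′
  ; to-adj   = λ {u} {v} → Equivalence.to (adj u v)
  ; from-adj = λ {u} {v} → Equivalence.from (adj (from f′ u) (from f′ v))
                 ∘ subst₂ (Adj H) (sym (strictlyInverseˡ f′ u)) (sym (strictlyInverseˡ f′ v)) }
  where f′ = ⤖⇒↔ f

↑ˡ-↔ : ∀ {m m′} k → Fin m ↔ Fin m′ → Fin (m + k) ↔ Fin (m′ + k)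
↑ˡ-↔ k f = ↔-trans +↔⊎ (↔-trans (f ⊎-↔ ↔-refl) (↔-sym +↔⊎))

↑ˡ-↔-↑ˡ : ∀ {m m′} k (f : Fin m ↔ Fin m′) i → to (↑ˡ-↔ k f) (i ↑ˡ k) ≡ to f i ↑ˡ k
↑ˡ-↔-↑ˡ {m} k f i rewrite splitAt-↑ˡ m i k = refl

addIsolated-cong : ∀ {G H} → G ≅ H → ∀ k → addIsolated G k ≅ addIsolated H k
addIsolated-cong φ k = record
  { vertices = ↑ˡ-↔ k (vertices φ) ; to-adj = lift-adj φ ; from-adj = lift-adj (≅-sym φ) }
  where
  lift-adj : ∀ {G H} (φ : G ≅ H) {u v} → AddAdj G k u v →
             AddAdj H k (to (↑ˡ-↔ k (vertices φ)) u) (to (↑ˡ-↔ k (vertices φ)) v)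
  lift-adj φ (i , j , refl , refl , a) =
    to f i , to f j , ↑ˡ-↔-↑ˡ k f i , ↑ˡ-↔-↑ˡ k f j , to-adj φ a
    where f = vertices φ

cast-↔ : ∀ {m m′} → m ≡ m′ → Fin m ↔ Fin m′
cast-↔ p = mk↔ₛ′ (cast p) (cast (sym p)) (cast-involutive p (sym p)) (cast-involutive (sym p) p)

toℕ-≡⇒cast-≡ : ∀ {m m′} (p : m ≡ m′) {x : Fin m} {y : Fin m′} → toℕ x ≡ toℕ y → cast p x ≡ y
toℕ-≡⇒cast-≡ p {x} e = toℕ-injective (trans (toℕ-cast p x) e)

addIsolated-assoc : ∀ G {a b c} → a + b ≡ c → addIsolated (addIsolated G a) b ≅ addIsolated G c
addIsolated-assoc G {a} {b} {c} a+b≡c = record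
  { vertices = cast-↔ p
  ; to-adj   = λ { (_ , _ , refl , refl , (i , j , refl , refl , adj)) →
      i , j , toℕ-≡⇒cast-≡ p (toℕ-↑ˡ↑ˡ i) , toℕ-≡⇒cast-≡ p (toℕ-↑ˡ↑ˡ j) , adj }
  ; from-adj = λ { (i , j , refl , refl , adj) →
      i ↑ˡ a , j ↑ˡ a ,
      toℕ-≡⇒cast-≡ (sym p) (sym (toℕ-↑ˡ↑ˡ i)) , toℕ-≡⇒cast-≡ (sym p) (sym (toℕ-↑ˡ↑ˡ j)) ,
      (i , j , refl , refl , adj) } }
  where
  p : n G + a + b ≡ n G + c
  p = trans (+-assoc (n G) a b) (cong (n G +_) a+b≡c)
  toℕ-↑ˡ↑ˡ : ∀ i → toℕ ((i ↑ˡ a) ↑ˡ b) ≡ toℕ (i ↑ˡ c)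
  toℕ-↑ˡ↑ˡ i = trans (toℕ-↑ˡ (i ↑ˡ a) b) (trans (toℕ-↑ˡ i a) (sym (toℕ-↑ˡ i c)))

addIsolated-comm : ∀ G a b → addIsolated (addIsolated G a) b ≅ addIsolated (addIsolated G b) a
addIsolated-comm G a b =
  ≅-trans (addIsolated-assoc G refl) (≅-sym (addIsolated-assoc G (+-comm b a)))

PocRep-resp-≅ : ∀ {G H d} → G ≅ H → PocRep H d → PocRep G d
PocRep-resp-≅ {H = H} φ (k , S , ψ) =
  k , S , ≅⇒Iso (≅-trans (addIsolated-cong φ k) (Iso⇒≅ {addIsolated H k} {compGraph S} ψ))

PocRep-addIsolated⁻ : ∀ {d} G j → PocRep (addIsolated G j) d → PocRep G d
PocRep-addIsolated⁻ G j (k , S , ψ) =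
  j + k , S , ≅⇒Iso (≅-trans (≅-sym (addIsolated-assoc G refl))
                              (Iso⇒≅ {addIsolated (addIsolated G j) k} {compGraph S} ψ))

record Detached {d} (S T : PointSet d) : Set where
  field
    distinct : ∀ a b → ¬ (∀ i → pt S a i ≡ pt T b i)
    ¬S≺T     : ∀ a b → ¬ pt S a ≺ pt T b
    ¬T≺S     : ∀ b a → ¬ pt T b ≺ pt S a
    ¬T≺T     : ∀ b b′ → ¬ pt T b ≺ pt T b′

module _ {d} {S T : PointSet d} (D : Detached S T) where
  open Detached D

  private
    points : Fin (m S + m T) → Point d
    points = [ pt S , pt T ]′ ∘ splitAt (m S)

    points-↑ˡ : ∀ a → points (a ↑ˡ m T) ≡ pt S a
    points-↑ˡ a rewrite splitAt-↑ˡ (m S) a (m T) = refl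

    [pt,pt]-injective : ∀ s t → (∀ i → [ pt S , pt T ]′ s i ≡ [ pt S , pt T ]′ t i) → s ≡ t
    [pt,pt]-injective (inj₁ a) (inj₁ a′) h = cong inj₁ (inj S a a′ h)
    [pt,pt]-injective (inj₁ a) (inj₂ b)  h = ⊥-elim (distinct a b h)
    [pt,pt]-injective (inj₂ b) (inj₁ a)  h = ⊥-elim (distinct a b (sym ∘ h))
    [pt,pt]-injective (inj₂ b) (inj₂ b′) h = cong inj₂ (inj T b b′ h)

    points-≺ : ∀ c x → points c ≺ points x →
               ∃₂ λ a b → c ≡ a ↑ˡ m T × x ≡ b ↑ˡ m T × pt S a ≺ pt S b
    points-≺ c x c≺x with splitAt (m S) c in c≡ | splitAt (m S) x in x≡
    ... | inj₁ a | inj₁ b  = a , b , sym (splitAt⁻¹-↑ˡ c≡) , sym (splitAt⁻¹-↑ˡ x≡) , c≺x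
    ... | inj₁ a | inj₂ b  = ⊥-elim (¬S≺T a b c≺x)
    ... | inj₂ b | inj₁ a  = ⊥-elim (¬T≺S b a c≺x)
    ... | inj₂ b | inj₂ b′ = ⊥-elim (¬T≺T b b′ c≺x)

  union : PointSet d
  union = record
    { m   = m S + m T
    ; pt  = points
    ; inj = λ x y h → Injection.injective (↔⇒↣ +↔⊎) ([pt,pt]-injective _ _ h) }

  compGraph-union : addIsolated (compGraph S) (m T) ≅ compGraph union
  compGraph-union = record { vertices = ↔-refl ; to-adj = to-adj′ ; from-adj = from-adj′ }
    where
    to-adj′ : ∀ {u v} → AddAdj (compGraph S) (m T) u v → Adj (compGraph union) u v
    to-adj′ (a , b , refl , refl , a≢b , c , c≺a , c≺b) =
      a≢b ∘ ↑ˡ-injective (m T) a b , c ↑ˡ m T ,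
      subst₂ _≺_ (sym (points-↑ˡ c)) (sym (points-↑ˡ a)) c≺a ,
      subst₂ _≺_ (sym (points-↑ˡ c)) (sym (points-↑ˡ b)) c≺b
    from-adj′ : ∀ {u v} → Adj (compGraph union) u v → AddAdj (compGraph S) (m T) u v
    from-adj′ {u} {v} (u≢v , c , c≺u , c≺v)
      with points-≺ c u c≺u | points-≺ c v c≺v
    ... | c₁ , a , refl , refl , c₁≺a | c₂ , b , c₁≡c₂ , refl , c₂≺b
      with refl ← ↑ˡ-injective (m T) c₁ c₂ c₁≡c₂
      = a , b , refl , refl , u≢v ∘ cong (_↑ˡ m T) , c₁ , c₁≺a , c₂≺b

neg-cancel-< : ∀ {p q} → - p < - q → q < p
neg-cancel-< {p} {q} = subst₂ _<_ (⁻¹-involutive q) (⁻¹-involutive p) ∘ neg-antimono-<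

antidiagonal : ∀ {e} → ℚ → Point (2 + e)
antidiagonal t zero          = t
antidiagonal t (suc zero)    = - t
antidiagonal t (suc (suc _)) = 0ℚ

antidiagonal-antichain : ∀ {e} s t → ¬ antidiagonal {e} s ≺ antidiagonal t
antidiagonal-antichain s t s≺t = <-asym (s≺t zero) (neg-cancel-< (s≺t (suc zero)))

reach : ∀ {e} → Point (2 + e) → ℚ
reach x = x zero ⊔ - x (suc zero)

module _ {e} {x : Point (2 + e)} {t : ℚ} (reach<t : reach x < t) where

  private
    x₀<t : x zero < t
    x₀<t = ≤-<-trans (p≤p⊔q (x zero) (- x (suc zero))) reach<t

    -x₁<t : - x (suc zero) < t
    -x₁<t = ≤-<-trans (p≤q⊔p (x zero) (- x (suc zero))) reach<t

  ≢-antidiagonal : ¬ (∀ i → x i ≡ antidiagonal t i)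
  ≢-antidiagonal x≡t = <-irrefl (x≡t zero) x₀<t

  ¬≺-antidiagonal : ¬ x ≺ antidiagonal t
  ¬≺-antidiagonal x≺t =
    <-asym -x₁<t (subst (_< - x (suc zero)) (⁻¹-involutive t) (neg-antimono-< (x≺t (suc zero))))

  ¬antidiagonal-≺ : ¬ antidiagonal t ≺ x
  ¬antidiagonal-≺ t≺x = <-asym x₀<t (t≺x zero)

module _ {e} (S : PointSet (2 + e)) where

  reachBound : ℚ
  reachBound = max 0ℚ (tabulate (reach ∘ pt S))

  reach≤reachBound : ∀ a → reach (pt S a) ≤ℚ reachBound
  reach≤reachBound = tabulate⁻ (xs≤max 0ℚ (tabulate (reach ∘ pt S)))

  height : ∀ {j} → Fin j → ℚ
  height i = reachBound +ℚ fromℤ ℤ.+[1+ toℕ i ]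

  reachBound<height : ∀ {j} (i : Fin j) → reachBound < height i
  reachBound<height i = subst (_< height i) (+-identityʳ reachBound)
                              (+-monoʳ-< reachBound (positive⁻¹ (fromℤ ℤ.+[1+ toℕ i ])))

  height-injective : ∀ {j} {i i′ : Fin j} → height i ≡ height i′ → i ≡ i′
  height-injective e =
    toℕ-injective (suc-injective (cong (ℤ.∣_∣ ∘ ℚ.numerator) (∙-cancelˡ reachBound _ _ e)))

  farAntichain : ℕ → PointSet (2 + e)
  farAntichain j = record
    { m = j ; pt = antidiagonal ∘ height ; inj = λ _ _ h → height-injective (h zero) }

  farAntichain-detached : ∀ j → Detached S (farAntichain j)
  farAntichain-detached j = record
    { distinct = λ a i → ≢-antidiagonal (reach<height a i)
    ; ¬S≺T     = λ a i → ¬≺-antidiagonal (reach<height a i)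
    ; ¬T≺S     = λ i a → ¬antidiagonal-≺ (reach<height a i)
    ; ¬T≺T     = λ i i′ → antidiagonal-antichain (height i) (height i′) }
    where
    reach<height : ∀ a (i : Fin j) → reach (pt S a) < height i
    reach<height a i = ≤-<-trans (reach≤reachBound a) (reachBound<height i)

compGraph-addIsolated : ∀ {d} → 2 ≤ d → (S : PointSet d) (j : ℕ) →
                        Σ[ S′ ∈ PointSet d ] addIsolated (compGraph S) j ≅ compGraph S′
compGraph-addIsolated (s≤s (s≤s z≤n)) S j =
  union (farAntichain-detached S j) , compGraph-union (farAntichain-detached S j)

PocRep-addIsolated⁺ : ∀ {d} → 2 ≤ d → ∀ G j → PocRep G d → PocRep (addIsolated G j) d
PocRep-addIsolated⁺ 2≤d G j (k , S , ψ) =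
  let S′ , χ = compGraph-addIsolated 2≤d S j in
  k , S′ , ≅⇒Iso (≅-trans (addIsolated-comm G j k)
                  (≅-trans (addIsolated-cong (Iso⇒≅ {addIsolated G k} {compGraph S} ψ) j) χ))

lemma3p11 : (G G′ : Graph) (d : ℕ) → IsPocDim G d → 2 ≤ d →
    (∃[ j ] Iso G′ (addIsolated G j)) → IsPocDim G′ d
lemma3p11 G G′ d (rep , minimal) 2≤d (j , G′≅G+j) =
  PocRep-resp-≅ φ (PocRep-addIsolated⁺ 2≤d G j rep) ,
  λ d′ rep′ → minimal d′ (PocRep-addIsolated⁻ G j (PocRep-resp-≅ (≅-sym φ) rep′))
  where
  φ : G′ ≅ addIsolated G j
  φ = Iso⇒≅ G′≅G+j
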